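{- Let $\mathcal{R}$ be a locally confluent and terminating rewrite system on terms. Then the proof reduction algorithm for asymmetric atomic deduction modulo $\mathcal{R}$ described below always succeeds: starting from any proof of a sequent, it terminates without failure and produces a cut-free proof of the same sequent.
   Context: Fix a first-order language. A rewrite rule is a pair of terms $l \rightarrow r$ with $l$ not a variable; a rewrite system is a set of rules. $\rightarrow^{1}$ is the smallest relation on terms and propositions compatible with their structure and containing $\theta l \rightarrow^{1} \theta r$ for every substitution $\theta$ and rule $l \rightarrow r$; $\rightarrow^{+}$ and $\rightarrow^{*}$ are its transitive and reflexive-transitive closures, $\leftarrow$ denotes converses. $\mathcal{R}$ is locally confluent if whenever $u \leftarrow^{1} t \rightarrow^{1} v$ there is $w$ with $u \rightarrow^{*} w \leftarrow^{*} v$; it is terminating if there is no infinite sequence $t_0 \rightarrow^{1} t_1 \rightarrow^{1} \cdots$. Two propositions have a common reduct $D$ if both rewrite to $D$ by $\rightarrow^{*}$. Asymmetric atomic deduction modulo $\mathcal{R}$: all propositions are atomic, sequents $\Gamma \vdash \Delta$ have finite multisets, and the rules are: Axiom labelled $(A)$: $\Gamma, A_1 \vdash A_2, \Delta$ provided $A_1 \rightarrow^{*} A \leftarrow^{*} A_2$; Cut with cut proposition $(C)$: from $\Gamma \vdash C_1, \Delta$ and $\Gamma, C_2 \vdash \Delta$ infer $\Gamma \vdash \Delta$ provided $C_1 \leftarrow^{*} C \rightarrow^{*} C_2$; contraction-left/right: from $\Gamma, A_1, A_2 \vdash \Delta$ (resp. $\Gamma \vdash A_1,A_2,\Delta$)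 infer $\Gamma, A \vdash \Delta$ (resp. $\Gamma \vdash A,\Delta$) provided $A_1 \leftarrow^{*} A \rightarrow^{*} A_2$; weakening-left/right. A cut-free proof of $\Gamma \vdash \Delta$ exists iff some $A \in \Gamma$ and $B \in \Delta$ have a common reduct. Reduction step: consider a proof ending with a Cut with cut proposition $C$, conclusion $\Gamma \vdash \Delta$, premises $\Gamma \vdash C_1, \Delta$ and $\Gamma, C_2 \vdash \Delta$ (with $C_1 \leftarrow^{*} C \rightarrow^{*} C_2$), both having cut-free proofs. (1) If some proposition of $\Gamma$ and some proposition of $\Delta$ have a common reduct $C'$, the proof is replaced by an Axiom $(C')$ proving $\Gamma \vdash \Delta$. Otherwise write $\Gamma = \Gamma', A$ and $\Delta = E, \Delta'$ where $A$ and $C_1$ have a common reduct $B$ and $E$ and $C_2$ have a common reduct $D$. (2) If $B = C$ or $C = D$, then $D$ or $B$ is a common reduct of $A$ and $E$ and the proof is replaced by the corresponding Axiom. Otherwise $B \leftarrow^{+} C \rightarrow^{+} D$, so pick $C'_1, C'_2$ with $C \rightarrow^{1} C'_1 \rightarrow^{*} B$ and $C \rightarrow^{1} C'_2 \rightarrow^{*} D$. (3) If $C'_1$ and $C'_2$ have a common reduct $C'$, the proof is replaced by the proof ending with a Cut $(C'_2)$ of conclusion $\Gamma', A \vdash E, \Delta'$ whose right premise is the Axiom $(D)$ proving $\Gamma', A, C'_2 \vdash E, \Delta'$ and whose left premise is a Cut $(C'_1)$ of conclusion $\Gamma', A \vdash C'_2, E, \Delta'$ with premises the Axiom $(B)$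 proving $\Gamma', A \vdash C'_1, C'_2, E, \Delta'$ and the Axiom $(C')$ proving $\Gamma', A, C'_1 \vdash C'_2, E, \Delta'$. If none of (1), (2), (3) applies, the reduction step fails. The proof reduction algorithm repeatedly applies the reduction step to a highest cut of the proof (one whose premises have cut-free proofs), until the proof is cut-free or a step fails. -}

module Defs where

open import Data.Nat using (ℕ)
open import Data.Vec using (Vec; []; _∷_)
open import Data.List using (List; _∷_)
open import Data.List.Membership.Propositional using (_∈_)
open import Data.List.Relation.Unary.Any using (here; there)
open import Data.List.Relation.Binary.Permutation.Propositional using (_↭_)
open import Data.Product using (Σ; ∃; ∃-syntax; _×_; _,_)
open import Function using (flip)
open import Relation.Nullary using (¬_)
open import Relation.Binary.PropositionalEquality using (_≡_; _≢_; refl)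
open import Relation.Binary.Construct.Closure.ReflexiveTransitive using (Star; ε)
open import Induction.WellFounded using (WellFounded; Acc)

record Signature : Set₁ where
  field
    Fun       : Set
    funArity  : Fun → ℕ
    Pred      : Set
    predArity : Pred → ℕ

module Language (S : Signature) where
  open Signature S

  data Term : Set where
    var : ℕ → Term
    fun : (f : Fun) → Vec Term (funArity f) → Term

  data Formula : Set where
    atom : (P : Pred) → Vec Term (predArity P) → Formula

  Substitution : Set
  Substitution = ℕ → Term

  mutual
    subst : Substitution → Term → Term
    subst θ (var x)    = θ x
    subst θ (fun f ts) = fun f (substs θ ts)

    substs : ∀ {n} → Substitution → Vec Term n → Vec Term n
    substs θ []       = []
    substs θ (t ∷ ts) = subst θ t ∷ substs θ ts

  record RewriteSystem : Set₁ where
    field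
      Rule        : Term → Term → Set
      lhs-not-var : ∀ {l r} → Rule l r → ∀ x → l ≢ var x

  module Rewriting (R : RewriteSystem) where
    open RewriteSystem R

    data _⇒ₜ_ : Term → Term → Set
    data _⇒ᵥ_ : ∀ {n} → Vec Term n → Vec Term n → Set

    data _⇒ₜ_ where
      root    : ∀ {l r} → Rule l r → (θ : Substitution) →
                subst θ l ⇒ₜ subst θ r
      cong-fun : ∀ (f : Fun) {ts us : Vec Term (funArity f)} →
                 ts ⇒ᵥ us → fun f ts ⇒ₜ fun f us

    data _⇒ᵥ_ where
      head : ∀ {n t u} {ts : Vec Term n} → t ⇒ₜ u → (t ∷ ts) ⇒ᵥ (u ∷ ts)
      tail : ∀ {n t} {ts us : Vec Term n} → ts ⇒ᵥ us → (t ∷ ts) ⇒ᵥ (t ∷ us)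

    data _⇒_ : Formula → Formula → Set where
      cong-atom : ∀ (P : Pred) {ts us : Vec Term (predArity P)} →
                  ts ⇒ᵥ us → atom P ts ⇒ atom P us

    _⇒ₜ*_ : Term → Term → Set
    _⇒ₜ*_ = Star _⇒ₜ_

    _⇒*_ : Formula → Formula → Set
    _⇒*_ = Star _⇒_

    LocallyConfluent : Set
    LocallyConfluent = ∀ {t u v} → t ⇒ₜ u → t ⇒ₜ v →
                       ∃[ w ] (u ⇒ₜ* w × v ⇒ₜ* w)

    Terminating : Set
    Terminating = WellFounded (flip _⇒ₜ_)

    -- Asymmetric atomic deduction modulo R.  Sequents are pairs of lists
    -- read as multisets.

    data Proof : List Formula → List Formula → Set where
      axiom  : ∀ {Γ Δ} (A A₁ A₂ : Formula) → A₁ ∈ Γ → A₂ ∈ Δ →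
               A₁ ⇒* A → A₂ ⇒* A → Proof Γ Δ
      cut    : ∀ {Γ Δ} (C C₁ C₂ : Formula) → C ⇒* C₁ → C ⇒* C₂ →
               Proof Γ (C₁ ∷ Δ) → Proof (C₂ ∷ Γ) Δ → Proof Γ Δ
      contrˡ : ∀ {Γ Γ′ Δ} (A A₁ A₂ : Formula) → Γ ↭ A ∷ Γ′ →
               A ⇒* A₁ → A ⇒* A₂ → Proof (A₁ ∷ A₂ ∷ Γ′) Δ → Proof Γ Δ
      contrʳ : ∀ {Γ Δ Δ′} (A A₁ A₂ : Formula) → Δ ↭ A ∷ Δ′ →
               A ⇒* A₁ → A ⇒* A₂ → Proof Γ (A₁ ∷ A₂ ∷ Δ′) → Proof Γ Δ
      weakˡ  : ∀ {Γ Γ′ Δ} (A : Formula) → Γ ↭ A ∷ Γ′ →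
               Proof Γ′ Δ → Proof Γ Δ
      weakʳ  : ∀ {Γ Δ Δ′} (A : Formula) → Δ ↭ A ∷ Δ′ →
               Proof Γ Δ′ → Proof Γ Δ

    data CutFree : ∀ {Γ Δ} → Proof Γ Δ → Set where
      axiom  : ∀ {Γ Δ A A₁ A₂ m₁ m₂ r₁ r₂} →
               CutFree (axiom {Γ} {Δ} A A₁ A₂ m₁ m₂ r₁ r₂)
      contrˡ : ∀ {Γ Γ′ Δ A A₁ A₂ p r₁ r₂ π} → CutFree π →
               CutFree (contrˡ {Γ} {Γ′} {Δ} A A₁ A₂ p r₁ r₂ π)
      contrʳ : ∀ {Γ Δ Δ′ A A₁ A₂ p r₁ r₂ π} → CutFree π →
               CutFree (contrʳ {Γ} {Δ} {Δ′} A A₁ A₂ p r₁ r₂ π)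
      weakˡ  : ∀ {Γ Γ′ Δ A p π} → CutFree π → CutFree (weakˡ {Γ} {Γ′} {Δ} A p π)
      weakʳ  : ∀ {Γ Δ Δ′ A p π} → CutFree π → CutFree (weakʳ {Γ} {Δ} {Δ′} A p π)

    CutFreeProvable : List Formula → List Formula → Set
    CutFreeProvable Γ Δ = Σ (Proof Γ Δ) CutFree

    SharedReduct : List Formula → List Formula → Set
    SharedReduct Γ Δ = ∃[ A ] ∃[ E ] ∃[ D ]
      (A ∈ Γ × E ∈ Δ × A ⇒* D × E ⇒* D)

    CommonReduct : Formula → Formula → Set
    CommonReduct X Y = ∃[ Z ] (X ⇒* Z × Y ⇒* Z)

    -- The reduction step, applied to a cut at the root of a proof whose
    -- premises have cut-free proofs (a highest cut).

    data RootStep {Γ Δ : List Formula} : Proof Γ Δ → Proof Γ Δ → Set where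
      step₁ : ∀ {C C₁ C₂ c₁ c₂ π₁ π₂} →
        CutFreeProvable Γ (C₁ ∷ Δ) → CutFreeProvable (C₂ ∷ Γ) Δ →
        (C′ A E : Formula) (mA : A ∈ Γ) (mE : E ∈ Δ)
        (rA : A ⇒* C′) (rE : E ⇒* C′) →
        RootStep (cut C C₁ C₂ c₁ c₂ π₁ π₂) (axiom C′ A E mA mE rA rE)
      step₂ᴮ : ∀ {C C₁ C₂ c₁ c₂ π₁ π₂} →
        CutFreeProvable Γ (C₁ ∷ Δ) → CutFreeProvable (C₂ ∷ Γ) Δ →
        ¬ SharedReduct Γ Δ →
        (A E B D : Formula) (mA : A ∈ Γ) (mE : E ∈ Δ) →
        A ⇒* B → C₁ ⇒* B → E ⇒* D → C₂ ⇒* D →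
        B ≡ C → (rA : A ⇒* D) (rE : E ⇒* D) →
        RootStep (cut C C₁ C₂ c₁ c₂ π₁ π₂) (axiom D A E mA mE rA rE)
      step₂ᴰ : ∀ {C C₁ C₂ c₁ c₂ π₁ π₂} →
        CutFreeProvable Γ (C₁ ∷ Δ) → CutFreeProvable (C₂ ∷ Γ) Δ →
        ¬ SharedReduct Γ Δ →
        (A E B D : Formula) (mA : A ∈ Γ) (mE : E ∈ Δ) →
        A ⇒* B → C₁ ⇒* B → E ⇒* D → C₂ ⇒* D →
        C ≡ D → (rA : A ⇒* B) (rE : E ⇒* B) →
        RootStep (cut C C₁ C₂ c₁ c₂ π₁ π₂) (axiom B A E mA mE rA rE)
      step₃ : ∀ {C C₁ C₂ c₁ c₂ π₁ π₂} →
        CutFreeProvable Γ (C₁ ∷ Δ) → CutFreeProvable (C₂ ∷ Γ) Δ →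
        ¬ SharedReduct Γ Δ →
        (A E B D : Formula) (mA : A ∈ Γ) (mE : E ∈ Δ) →
        (rAB : A ⇒* B) → C₁ ⇒* B → (rED : E ⇒* D) → C₂ ⇒* D →
        B ≢ C → C ≢ D →
        (C₁′ C₂′ : Formula) → C ⇒ C₁′ → (r₁ : C₁′ ⇒* B) →
        C ⇒ C₂′ → (r₂ : C₂′ ⇒* D) →
        (C′ : Formula) (s₁ : C₁′ ⇒* C′) (s₂ : C₂′ ⇒* C′) →
        RootStep (cut C C₁ C₂ c₁ c₂ π₁ π₂)
          (cut C₂′ C₂′ C₂′ ε ε
            (cut C₁′ C₁′ C₁′ ε ε
              (axiom B A C₁′ mA (here refl) rAB r₁)
              (axiom C′ C₁′ C₂′ (here refl) (here refl) s₁ s₂))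
            (axiom D C₂′ E (here refl) mE r₂ rED))

    data RootFail {Γ Δ : List Formula} : Proof Γ Δ → Set where
      fail : ∀ {C C₁ C₂ c₁ c₂ π₁ π₂} →
        CutFreeProvable Γ (C₁ ∷ Δ) → CutFreeProvable (C₂ ∷ Γ) Δ →
        ¬ SharedReduct Γ Δ →
        (A E B D : Formula) → A ∈ Γ → E ∈ Δ →
        A ⇒* B → C₁ ⇒* B → E ⇒* D → C₂ ⇒* D →
        B ≢ C → C ≢ D →
        (C₁′ C₂′ : Formula) → C ⇒ C₁′ → C₁′ ⇒* B →
        C ⇒ C₂′ → C₂′ ⇒* D →
        ¬ CommonReduct C₁′ C₂′ →
        RootFail (cut C C₁ C₂ c₁ c₂ π₁ π₂)

    data _⟶_ : ∀ {Γ Δ} → Proof Γ Δ → Proof Γ Δ → Set where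
      at     : ∀ {Γ Δ} {π π′ : Proof Γ Δ} → RootStep π π′ → π ⟶ π′
      cutₗ   : ∀ {Γ Δ C C₁ C₂ c₁ c₂ π₁ π₁′ π₂} → π₁ ⟶ π₁′ →
               cut {Γ} {Δ} C C₁ C₂ c₁ c₂ π₁ π₂ ⟶ cut C C₁ C₂ c₁ c₂ π₁′ π₂
      cutᵣ   : ∀ {Γ Δ C C₁ C₂ c₁ c₂ π₁ π₂ π₂′} → π₂ ⟶ π₂′ →
               cut {Γ} {Δ} C C₁ C₂ c₁ c₂ π₁ π₂ ⟶ cut C C₁ C₂ c₁ c₂ π₁ π₂′
      contrˡ : ∀ {Γ Γ′ Δ A A₁ A₂ p r₁ r₂ π π′} → π ⟶ π′ →
               contrˡ {Γ} {Γ′} {Δ} A A₁ A₂ p r₁ r₂ π ⟶ contrˡ A A₁ A₂ p r₁ r₂ π′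
      contrʳ : ∀ {Γ Δ Δ′ A A₁ A₂ p r₁ r₂ π π′} → π ⟶ π′ →
               contrʳ {Γ} {Δ} {Δ′} A A₁ A₂ p r₁ r₂ π ⟶ contrʳ A A₁ A₂ p r₁ r₂ π′
      weakˡ  : ∀ {Γ Γ′ Δ A p π π′} → π ⟶ π′ →
               weakˡ {Γ} {Γ′} {Δ} A p π ⟶ weakˡ A p π′
      weakʳ  : ∀ {Γ Δ Δ′ A p π π′} → π ⟶ π′ →
               weakʳ {Γ} {Δ} {Δ′} A p π ⟶ weakʳ A p π′

    data Fails : ∀ {Γ Δ} → Proof Γ Δ → Set where
      at     : ∀ {Γ Δ} {π : Proof Γ Δ} → RootFail π → Fails π
      cutₗ   : ∀ {Γ Δ C C₁ C₂ c₁ c₂ π₁ π₂} → Fails π₁ →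
               Fails (cut {Γ} {Δ} C C₁ C₂ c₁ c₂ π₁ π₂)
      cutᵣ   : ∀ {Γ Δ C C₁ C₂ c₁ c₂ π₁ π₂} → Fails π₂ →
               Fails (cut {Γ} {Δ} C C₁ C₂ c₁ c₂ π₁ π₂)
      contrˡ : ∀ {Γ Γ′ Δ A A₁ A₂ p r₁ r₂ π} → Fails π →
               Fails (contrˡ {Γ} {Γ′} {Δ} A A₁ A₂ p r₁ r₂ π)
      contrʳ : ∀ {Γ Δ Δ′ A A₁ A₂ p r₁ r₂ π} → Fails π →
               Fails (contrʳ {Γ} {Δ} {Δ′} A A₁ A₂ p r₁ r₂ π)
      weakˡ  : ∀ {Γ Γ′ Δ A p π} → Fails π → Fails (weakˡ {Γ} {Γ′} {Δ} A p π)
      weakʳ  : ∀ {Γ Δ Δ′ A p π} → Fails π → Fails (weakʳ {Γ} {Δ} {Δ′} A p π)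

    Stopped : ∀ {Γ Δ} → Proof Γ Δ → Set
    Stopped π = ∀ π′ → ¬ (π ⟶ π′)

    -- The algorithm succeeds from π: every run from π is finite (π is
    -- accessible for the converse of ⟶), and every proof reached from π
    -- admits no failing step and, if no step applies, is cut-free.
    -- (All proofs reached have the same conclusion Γ ⊢ Δ by typing.)
    Succeeds : ∀ {Γ Δ} → Proof Γ Δ → Set
    Succeeds {Γ} {Δ} π =
      Acc (flip (_⟶_ {Γ} {Δ})) π ×
      (∀ π′ → Star (_⟶_ {Γ} {Δ}) π π′ →
         ¬ Fails π′ × (Stopped π′ → CutFree π′))

-- Local confluence and termination lift from terms to atomic propositions,
-- so by Newman's lemma rewriting on propositions is confluent.  At a highest
-- cut the cut-free premises give either a shared reduct of Γ and Δ directly,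
-- or A ∈ Γ joinable with C₁ and E ∈ Δ joinable with C₂; as C₁ and C₂ are
-- reducts of C, confluence joins A and E.  Hence case (1) of the reduction
-- step always applies, and case (3) could not fail anyway since local
-- confluence joins C₁′ and C₂′.  The algorithm terminates because each step
-- either turns a cut into an axiom or, in case (3), replaces a cut on C by
-- cuts on one-step reducts of C; this is well founded by termination.
module Submission where

open import Defs
open import Data.Nat using (suc)
open import Data.Vec using (Vec; []; _∷_)
open import Data.List using (List; _∷_)
open import Data.List.Membership.Propositional using (_∈_)
open import Data.List.Relation.Unary.Any using (here; there)
open import Data.List.Relation.Binary.Permutation.Propositional using (_↭_; ↭-sym)
open import Data.List.Relation.Binary.Permutation.Propositional.Properties using (∈-resp-↭)
open import Data.Product using (∃; ∃-syntax; _×_; _,_; -,_; map₂)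
open import Data.Sum using (_⊎_; inj₁; inj₂)
import Data.Sum as Sum
open import Data.Empty using (⊥-elim)
open import Function using (flip)
open import Level using (Level)
open import Relation.Nullary using (¬_)
open import Relation.Binary.Core using (Rel)
open import Relation.Binary.PropositionalEquality using (refl)
open import Relation.Binary.Construct.Closure.ReflexiveTransitive using (ε; _◅_; _◅◅_; gmap)
open import Relation.Binary.Construct.Closure.Transitive using (Plus; [_]; _∼⁺⟨_⟩_; TransClosure; _++_)
import Relation.Binary.Construct.Closure.Transitive as TransClosure
open import Relation.Binary.Rewriting using (Confluent; WeaklyConfluent; StronglyNormalizing; sn&wcr⇒cr)
open import Induction.WellFounded using (WellFounded; Acc; acc; module Subrelation)

module _ {a ℓ : Level} {A : Set a} {_⟶_ : Rel A ℓ} where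

  Plus⇒TransClosure-converse : ∀ {x y} → Plus _⟶_ x y → TransClosure (flip _⟶_) y x
  Plus⇒TransClosure-converse [ x⟶y ]     = [ x⟶y ]
  Plus⇒TransClosure-converse (_ ∼⁺⟨ p ⟩ q) =
    Plus⇒TransClosure-converse q ++ Plus⇒TransClosure-converse p

  wellFounded⇒stronglyNormalizing⁺ : WellFounded (flip _⟶_) → StronglyNormalizing (Plus _⟶_)
  wellFounded⇒stronglyNormalizing⁺ wf =
    Subrelation.wellFounded Plus⇒TransClosure-converse
      (TransClosure.wellFounded (flip _⟶_) wf)

  newman : WellFounded (flip _⟶_) → WeaklyConfluent _⟶_ → Confluent _⟶_
  newman wf = sn&wcr⇒cr (wellFounded⇒stronglyNormalizing⁺ wf)

module AtomicDeduction (S : Signature) (R : Language.RewriteSystem S) where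
  open Signature S using (predArity)
  open Language S
  open Rewriting R

  ⇒ᵥ-weaklyConfluent : WeaklyConfluent _⇒ₜ_ → ∀ {n} → WeaklyConfluent (_⇒ᵥ_ {n})
  ⇒ᵥ-weaklyConfluent lc {B = _ ∷ ts} (head p) (head q) with lc p q
  ... | w , p* , q* = w ∷ ts , gmap (_∷ ts) head p* , gmap (_∷ ts) head q*
  ⇒ᵥ-weaklyConfluent lc (head p) (tail q) = -, tail q ◅ ε , head p ◅ ε
  ⇒ᵥ-weaklyConfluent lc (tail p) (head q) = -, head q ◅ ε , tail p ◅ ε
  ⇒ᵥ-weaklyConfluent lc {B = t ∷ _} (tail p) (tail q) with ⇒ᵥ-weaklyConfluent lc p q
  ... | ws , p* , q* = t ∷ ws , gmap (t ∷_) tail p* , gmap (t ∷_) tail q*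

  ⇒-weaklyConfluent : LocallyConfluent → WeaklyConfluent _⇒_
  ⇒-weaklyConfluent lc (cong-atom P p) (cong-atom .P q) with ⇒ᵥ-weaklyConfluent lc p q
  ... | ws , p* , q* = atom P ws , gmap (atom P) (cong-atom P) p* , gmap (atom P) (cong-atom P) q*

  ∷-acc : ∀ {n t} {ts : Vec Term n} → Acc (flip _⇒ₜ_) t → Acc (flip (_⇒ᵥ_ {n})) ts →
          Acc (flip (_⇒ᵥ_ {suc n})) (t ∷ ts)
  ∷-acc acc[t]@(acc rec-t) acc[ts]@(acc rec-ts) = acc λ where
    (head p) → ∷-acc (rec-t p) acc[ts]
    (tail p) → ∷-acc acc[t] (rec-ts p)

  ⇒ᵥ-wellFounded : Terminating → ∀ {n} → WellFounded (flip (_⇒ᵥ_ {n}))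
  ⇒ᵥ-wellFounded wf []       = acc λ ()
  ⇒ᵥ-wellFounded wf (t ∷ ts) = ∷-acc (wf t) (⇒ᵥ-wellFounded wf ts)

  atom-acc : ∀ {P} {ts : Vec Term (predArity P)} →
             Acc (flip (_⇒ᵥ_ {predArity P})) ts → Acc (flip _⇒_) (atom P ts)
  atom-acc (acc rec) = acc λ { (cong-atom P p) → atom-acc (rec p) }

  ⇒-wellFounded : Terminating → WellFounded (flip _⇒_)
  ⇒-wellFounded wf (atom P ts) = atom-acc (⇒ᵥ-wellFounded wf ts)

  ⇒-confluent : LocallyConfluent → Terminating → Confluent _⇒_
  ⇒-confluent lc wf = newman (⇒-wellFounded wf) (⇒-weaklyConfluent lc)

  infix 4 _≼_

  _≼_ : List Formula → List Formula → Set
  Γ₁ ≼ Γ₂ = ∀ {X} → X ∈ Γ₁ → ∃[ Y ] (Y ∈ Γ₂ × Y ⇒* X)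

  ≼-refl : ∀ {Γ} → Γ ≼ Γ
  ≼-refl m = -, m , ε

  weakening-≼ : ∀ {Γ Γ′ A} → Γ ↭ A ∷ Γ′ → Γ′ ≼ Γ
  weakening-≼ p m = -, ∈-resp-↭ (↭-sym p) (there m) , ε

  contraction-≼ : ∀ {Γ Γ′ A A₁ A₂} → Γ ↭ A ∷ Γ′ → A ⇒* A₁ → A ⇒* A₂ → A₁ ∷ A₂ ∷ Γ′ ≼ Γ
  contraction-≼ p r₁ r₂ (here refl)         = -, ∈-resp-↭ (↭-sym p) (here refl) , r₁
  contraction-≼ p r₁ r₂ (there (here refl)) = -, ∈-resp-↭ (↭-sym p) (here refl) , r₂
  contraction-≼ p r₁ r₂ (there (there m))   = -, ∈-resp-↭ (↭-sym p) (there m) , ε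

  sharedReduct-mono : ∀ {Γ₁ Γ₂ Δ₁ Δ₂} → Γ₁ ≼ Γ₂ → Δ₁ ≼ Δ₂ →
                      SharedReduct Γ₁ Δ₁ → SharedReduct Γ₂ Δ₂
  sharedReduct-mono Γ₁≼Γ₂ Δ₁≼Δ₂ (_ , _ , D , mX , mE , rX , rE)
    with Γ₁≼Γ₂ mX | Δ₁≼Δ₂ mE
  ... | Y , mY , rY | F , mF , rF = Y , F , D , mY , mF , rY ◅◅ rX , rF ◅◅ rE

  cutFree⇒sharedReduct : ∀ {Γ Δ} {π : Proof Γ Δ} → CutFree π → SharedReduct Γ Δ
  cutFree⇒sharedReduct (axiom {A = A} {m₁ = m₁} {m₂} {r₁} {r₂}) = -, -, A , m₁ , m₂ , r₁ , r₂
  cutFree⇒sharedReduct (contrˡ {p = p} {r₁ = r₁} {r₂ = r₂} cf) =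
    sharedReduct-mono (contraction-≼ p r₁ r₂) ≼-refl (cutFree⇒sharedReduct cf)
  cutFree⇒sharedReduct (contrʳ {p = p} {r₁ = r₁} {r₂ = r₂} cf) =
    sharedReduct-mono ≼-refl (contraction-≼ p r₁ r₂) (cutFree⇒sharedReduct cf)
  cutFree⇒sharedReduct (weakˡ {p = p} cf) =
    sharedReduct-mono (weakening-≼ p) ≼-refl (cutFree⇒sharedReduct cf)
  cutFree⇒sharedReduct (weakʳ {p = p} cf) =
    sharedReduct-mono ≼-refl (weakening-≼ p) (cutFree⇒sharedReduct cf)

  ¬fails : WeaklyConfluent _⇒_ → ∀ {Γ Δ} {π : Proof Γ Δ} → ¬ Fails π
  ¬fails lc (at (fail _ _ _ _ _ _ _ _ _ _ _ _ _ _ _ _ _ p₁ _ p₂ _ ¬joinable)) = ¬joinable (lc p₁ p₂)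
  ¬fails lc (cutₗ f)   = ¬fails lc f
  ¬fails lc (cutᵣ f)   = ¬fails lc f
  ¬fails lc (contrˡ f) = ¬fails lc f
  ¬fails lc (contrʳ f) = ¬fails lc f
  ¬fails lc (weakˡ f)  = ¬fails lc f
  ¬fails lc (weakʳ f)  = ¬fails lc f

  highestCut-rootStep : Confluent _⇒_ → ∀ {Γ Δ C C₁ C₂ c₁ c₂ π₁ π₂} → CutFree π₁ → CutFree π₂ →
                        ∃[ π′ ] RootStep (cut {Γ} {Δ} C C₁ C₂ c₁ c₂ π₁ π₂) π′
  highestCut-rootStep conf {c₁ = c₁} {c₂} {π₁} {π₂} cf₁ cf₂
    with cutFree⇒sharedReduct cf₁ | cutFree⇒sharedReduct cf₂
  ... | A , E , B , mA , there mE , rA , rE | _ =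
    -, step₁ (π₁ , cf₁) (π₂ , cf₂) B A E mA mE rA rE
  ... | _ | A , E , D , there mA , mE , rA , rE =
    -, step₁ (π₁ , cf₁) (π₂ , cf₂) D A E mA mE rA rE
  ... | A , _ , B , mA , here refl , rA , r₁ | _ , E , D , here refl , mE , r₂ , rE
    with conf (c₁ ◅◅ r₁) (c₂ ◅◅ r₂)
  ... | W , rB , rD = -, step₁ (π₁ , cf₁) (π₂ , cf₂) W A E mA mE (rA ◅◅ rB) (rE ◅◅ rD)

  progress : Confluent _⇒_ → ∀ {Γ Δ} (π : Proof Γ Δ) → CutFree π ⊎ ∃ (π ⟶_)
  progress conf (axiom _ _ _ _ _ _ _) = inj₁ axiom
  progress conf (cut _ _ _ _ _ π₁ π₂) with progress conf π₁ | progress conf π₂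
  ... | inj₂ (_ , s) | _            = inj₂ (-, cutₗ s)
  ... | inj₁ _       | inj₂ (_ , s) = inj₂ (-, cutᵣ s)
  ... | inj₁ cf₁     | inj₁ cf₂     = inj₂ (map₂ at (highestCut-rootStep conf cf₁ cf₂))
  progress conf (contrˡ _ _ _ _ _ _ π) = Sum.map contrˡ (λ (_ , s) → -, contrˡ s) (progress conf π)
  progress conf (contrʳ _ _ _ _ _ _ π) = Sum.map contrʳ (λ (_ , s) → -, contrʳ s) (progress conf π)
  progress conf (weakˡ _ _ π)          = Sum.map weakˡ (λ (_ , s) → -, weakˡ s) (progress conf π)
  progress conf (weakʳ _ _ π)          = Sum.map weakʳ (λ (_ , s) → -, weakʳ s) (progress conf π)

  stopped⇒cutFree : Confluent _⇒_ → ∀ {Γ Δ} (π : Proof Γ Δ) → Stopped π → CutFree π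
  stopped⇒cutFree conf π stopped with progress conf π
  ... | inj₁ cf       = cf
  ... | inj₂ (π′ , s) = ⊥-elim (stopped π′ s)

  AccProof : ∀ {Γ Δ} → Proof Γ Δ → Set
  AccProof {Γ} {Δ} = Acc (flip (_⟶_ {Γ} {Δ}))

  axiom-acc : ∀ {Γ Δ A A₁ A₂ m₁ m₂ r₁ r₂} → AccProof (axiom {Γ} {Δ} A A₁ A₂ m₁ m₂ r₁ r₂)
  axiom-acc = acc λ { (at ()) }

  cut-acc : ∀ {Γ Δ C C₁ C₂ c₁ c₂ π₁ π₂} → Acc (flip _⇒_) C → AccProof π₁ → AccProof π₂ →
            AccProof (cut {Γ} {Δ} C C₁ C₂ c₁ c₂ π₁ π₂)
  cut-acc acc[C] acc[π₁] acc[π₂] = acc (cut-step-acc acc[C] acc[π₁] acc[π₂])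
    where
    cut-step-acc : ∀ {Γ Δ C C₁ C₂ c₁ c₂ π₁ π₂} → Acc (flip _⇒_) C → AccProof π₁ → AccProof π₂ →
                   ∀ {π′} → cut {Γ} {Δ} C C₁ C₂ c₁ c₂ π₁ π₂ ⟶ π′ → AccProof π′
    cut-step-acc acc[C] (acc rec₁) acc[π₂] (cutₗ s) = cut-acc acc[C] (rec₁ s) acc[π₂]
    cut-step-acc acc[C] acc[π₁] (acc rec₂) (cutᵣ s) = cut-acc acc[C] acc[π₁] (rec₂ s)
    cut-step-acc _ _ _ (at (step₁ _ _ _ _ _ _ _ _ _)) = axiom-acc
    cut-step-acc _ _ _ (at (step₂ᴮ _ _ _ _ _ _ _ _ _ _ _ _ _ _ _ _)) = axiom-acc
    cut-step-acc _ _ _ (at (step₂ᴰ _ _ _ _ _ _ _ _ _ _ _ _ _ _ _ _)) = axiom-acc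
    cut-step-acc (acc rec-C) _ _ (at (step₃ _ _ _ _ _ _ _ _ _ _ _ _ _ _ _ _ _ C⇒C₁′ _ C⇒C₂′ _ _ _ _)) =
      cut-acc (rec-C C⇒C₂′) (cut-acc (rec-C C⇒C₁′) axiom-acc axiom-acc) axiom-acc

  contrˡ-acc : ∀ {Γ Γ′ Δ A A₁ A₂ p r₁ r₂ π} → AccProof π →
               AccProof (contrˡ {Γ} {Γ′} {Δ} A A₁ A₂ p r₁ r₂ π)
  contrˡ-acc (acc rec) = acc λ { (contrˡ s) → contrˡ-acc (rec s) ; (at ()) }

  contrʳ-acc : ∀ {Γ Δ Δ′ A A₁ A₂ p r₁ r₂ π} → AccProof π →
               AccProof (contrʳ {Γ} {Δ} {Δ′} A A₁ A₂ p r₁ r₂ π)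
  contrʳ-acc (acc rec) = acc λ { (contrʳ s) → contrʳ-acc (rec s) ; (at ()) }

  weakˡ-acc : ∀ {Γ Γ′ Δ A p π} → AccProof π → AccProof (weakˡ {Γ} {Γ′} {Δ} A p π)
  weakˡ-acc (acc rec) = acc λ { (weakˡ s) → weakˡ-acc (rec s) ; (at ()) }

  weakʳ-acc : ∀ {Γ Δ Δ′ A p π} → AccProof π → AccProof (weakʳ {Γ} {Δ} {Δ′} A p π)
  weakʳ-acc (acc rec) = acc λ { (weakʳ s) → weakʳ-acc (rec s) ; (at ()) }

  ⟶-wellFounded : WellFounded (flip _⇒_) → ∀ {Γ Δ} → WellFounded (flip (_⟶_ {Γ} {Δ}))
  ⟶-wellFounded wf (axiom _ _ _ _ _ _ _)  = axiom-acc
  ⟶-wellFounded wf (cut C _ _ _ _ π₁ π₂)  = cut-acc (wf C) (⟶-wellFounded wf π₁) (⟶-wellFounded wf π₂)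
  ⟶-wellFounded wf (contrˡ _ _ _ _ _ _ π) = contrˡ-acc (⟶-wellFounded wf π)
  ⟶-wellFounded wf (contrʳ _ _ _ _ _ _ π) = contrʳ-acc (⟶-wellFounded wf π)
  ⟶-wellFounded wf (weakˡ _ _ π)          = weakˡ-acc (⟶-wellFounded wf π)
  ⟶-wellFounded wf (weakʳ _ _ π)          = weakʳ-acc (⟶-wellFounded wf π)

corollary1 : (S : Signature) (R : Language.RewriteSystem S) →
    Language.Rewriting.LocallyConfluent S R →
    Language.Rewriting.Terminating S R →
    ∀ {Γ Δ} (π : Language.Rewriting.Proof S R Γ Δ) →
    Language.Rewriting.Succeeds S R π
corollary1 S R lc wf π =
  ⟶-wellFounded (⇒-wellFounded wf) π ,
  λ π′ _ → ¬fails (⇒-weaklyConfluent lc) , stopped⇒cutFree (⇒-confluent lc wf) π′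
  where open AtomicDeduction S R
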